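{- Let $Q$ be a weak primary pseudoperfect number such that $\mathfrak{N}_Q=\{n\in\mathbb{N}: S_{Qn}(Qn)\equiv n\pmod{Qn}\}$ is non-empty, and let $$\mathfrak{n}_Q:=\begin{cases}\operatorname{lcm}\left\{\frac{p-1}{\gcd(p-1,Q)} : p \text{ prime}, p\mid Q\right\}, & Q\neq 1,\\ 1, & Q=1.\end{cases}$$ Then $$\{\mathfrak{n}_Q k: k\in\mathbb{N}\}\setminus\mathfrak{N}_Q=\bigcup_{d\mid Q} W_d(Q),$$ where for each positive divisor $d$ of $Q$, $$W_d(Q):=\left\{Kp\,\frac{\mathfrak{n}_Q}{D}\,\frac{p-1}{d}: p \text{ prime},\ p\nmid Q,\ d\mid p-1,\ D=\gcd\left(\mathfrak{n}_Q,\frac{p(p-1)}{d}\right),\ K\in\mathbb{N}\right\}.$$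
   Context: $\mathbb{N}=\{1,2,3,\dots\}$. For positive integers $m,k$, $S_m(k):=1^m+2^m+\cdots+k^m$. A positive integer $Q$ is a weak primary pseudoperfect number if $\sum_{p\mid Q}\frac{Q}{p}+1\equiv 0\pmod{Q}$, the sum over primes $p$ dividing $Q$. -}

module Defs where

open import Data.Nat using (ℕ; zero; suc; _+_; _*_; _∸_; _^_; _≤_; _/_; ∣_-_∣)
open import Data.Nat.Divisibility using (_∣_; _∣?_)
open import Data.Nat.GCD using (gcd)
open import Data.Nat.LCM using (lcm)
open import Data.Nat.Primality using (Prime; prime?)
open import Data.List using (List; filter; map; foldr; upTo)
open import Data.Nat.ListAction using (sum)
open import Relation.Binary.PropositionalEquality using (_≡_)
open import Data.Product using (_×_; ∃-syntax)
open import Relation.Nullary using (¬_)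
open import Relation.Nullary.Decidable using (_×-dec_)

S : ℕ → ℕ → ℕ
S m zero    = 0
S m (suc k) = S m k + suc k ^ m

-- natural-number division, used only where the divisor is positive
infixl 7 _div_
_div_ : ℕ → ℕ → ℕ
a div zero    = 0
a div (suc b) = a / suc b

_≡_[mod_] : ℕ → ℕ → ℕ → Set
a ≡ b [mod m ] = m ∣ ∣ a - b ∣

primeDivisors : ℕ → List ℕ
primeDivisors Q = filter (λ p → prime? p ×-dec p ∣? Q) (upTo (suc Q))

WeakPrimaryPseudoperfect : ℕ → Set
WeakPrimaryPseudoperfect Q =
  1 ≤ Q × (sum (map (λ p → Q div p) (primeDivisors Q)) + 1) ≡ 0 [mod Q ]

𝔑 : ℕ → ℕ → Set
𝔑 Q n = 1 ≤ n × S (Q * n) (Q * n) ≡ n [mod Q * n ]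

lcmList : List ℕ → ℕ
lcmList = foldr lcm 1

𝔫 : ℕ → ℕ
𝔫 (suc zero) = 1
𝔫 Q = lcmList (map (λ p → (p ∸ 1) div gcd (p ∸ 1) Q) (primeDivisors Q))

W : ℕ → ℕ → ℕ → Set
W d Q m = ∃[ p ] ∃[ K ]
  (Prime p × ¬ (p ∣ Q) × d ∣ (p ∸ 1) × 1 ≤ K ×
   m ≡ K * p * (𝔫 Q div gcd (𝔫 Q) ((p * (p ∸ 1)) div d)) * ((p ∸ 1) div d))

MultOf𝔫 : ℕ → ℕ → Set
MultOf𝔫 Q m = ∃[ k ] (1 ≤ k × m ≡ 𝔫 Q * k)

{-# OPTIONS --safe #-}

-- Write k = Q m.  By Fermat's little theorem S_k(p) ≡ -1 (mod p) when (p - 1) ∣ k and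
-- S_k(p) ≡ 0 otherwise; and when p ∣ k and p ∣ N, i ↦ i^k has period N modulo N p, so for
-- k = c p^(e+1) one gets S_k(k) ≡ c p^e S_k(p) (mod p^(e+1)).  For a prime p ∣ Q we have
-- (p - 1) ∣ Q 𝔫_Q ∣ k, and the pseudoperfect congruence m (Σ_{q ∣ Q} Q/q + 1) ≡ 0 (mod Q m)
-- gives m ≡ -c p^e as well.  Hence a multiple m of 𝔫_Q lies in 𝔑_Q unless some prime p ∤ Q
-- divides m with (p - 1) ∣ Q m; and such a prime cannot exist for m ∈ 𝔑_Q, since there
-- p^(e+1) ∣ Q m forces p^(e+2) ∣ Q m.  Finally such a prime exists exactly when m ∈ W_d(Q)
-- for d = gcd(p - 1, Q): the conditions on p amount to lcm(𝔫_Q, p (p - 1)/d) ∣ m.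

module Submission where

open import Defs
open import Data.Nat.Base
open import Data.Nat.Properties
open import Data.Nat.Divisibility
open import Data.Nat.DivMod using (m≡m%n+[m/n]*n; m%n<n; m/n*n≡m; m≥n⇒m/n>0; *-/-assoc)
open import Data.Nat.GCD using (gcd; gcd[m,n]∣m; gcd[m,n]∣n; gcd[m,n]≡0⇒n≡0)
open import Data.Nat.LCM using (lcm; m∣lcm[m,n]; n∣lcm[m,n]; lcm-least; gcd*lcm)
open import Data.Nat.Coprimality as Coprime using (Coprime; coprime-/gcd; coprime-divisor; prime⇒coprime)
open import Data.Nat.Combinatorics using (_C_; nC1≡n; nCn≡1; k>n⇒nCk≡0; nCk+nC[k+1]≡[n+1]C[k+1])
open import Data.Nat.Primality using (Prime; prime?; euclidsLemma; prime⇒nonTrivial; prime⇒irreducible)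
open import Data.Nat.Primality.Factorisation using (factorise)
open import Data.Nat.Induction using (<-rec)
open import Data.Nat.ListAction using (sum; product)
open import Data.Nat.Tactic.RingSolver using (solve-∀)
open import Data.Integer.Base as ℤ using (ℤ; +_)
import Data.Integer.Properties as ℤ
import Data.Integer.Divisibility.Signed as ℤ
import Data.Integer.Tactic.RingSolver as ℤ
open import Data.List.Base using ([]; _∷_; map; upTo)
open import Data.List.Membership.Propositional using (_∈_; lose)
open import Data.List.Membership.Propositional.Properties using (∈-filter⁺; ∈-filter⁻; ∈-map⁺; ∈-map⁻; ∈-upTo⁺)
open import Data.List.Relation.Unary.Any using (Any; here; there; satisfied; any?)
import Data.List.Relation.Unary.All as All
open import Data.List.Relation.Unary.AllPairs using (_∷_)
open import Data.List.Relation.Unary.Unique.Propositional using (Unique)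
import Data.List.Relation.Unary.Unique.Propositional.Properties as Unique
open import Data.Product using (_×_; _,_; proj₁; proj₂; ∃-syntax)
open import Data.Sum using (inj₁; inj₂)
open import Function.Base using (case_of_)
open import Relation.Nullary using (¬_; Dec; yes; no; contradiction)
open import Relation.Nullary.Decidable using (_×-dec_; ¬?; map′)
open import Relation.Binary.PropositionalEquality

-- Congruences are taken in ℤ because the residues -1 and -c p^e occur.
infix 4 _≡_⟨mod_⟩
record _≡_⟨mod_⟩ (a b : ℤ) (n : ℕ) : Set where
  constructor mkCong
  field modulus∣difference : + n ℤ.∣ (a ℤ.- b)

module _ {n : ℕ} where

  ≡mod-refl : ∀ {a} → a ≡ a ⟨mod n ⟩
  ≡mod-refl {a} = mkCong (ℤ.divides (+ 0) (trans (ℤ.+-inverseʳ a) (sym (ℤ.*-zeroˡ (+ n)))))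

  ≡mod-sym : ∀ {a b} → a ≡ b ⟨mod n ⟩ → b ≡ a ⟨mod n ⟩
  ≡mod-sym {a} {b} (mkCong n∣a-b) = mkCong (subst (+ n ℤ.∣_) (negate-diff a b) (ℤ.∣m⇒∣-m n∣a-b))
    where
    negate-diff : ∀ a b → ℤ.- (a ℤ.- b) ≡ b ℤ.- a
    negate-diff = ℤ.solve-∀

  ≡mod-trans : ∀ {a b c} → a ≡ b ⟨mod n ⟩ → b ≡ c ⟨mod n ⟩ → a ≡ c ⟨mod n ⟩
  ≡mod-trans {a} {b} {c} (mkCong n∣a-b) (mkCong n∣b-c) =
    mkCong (subst (+ n ℤ.∣_) (ℤ.+-minus-telescope a b c) (ℤ.∣m∣n⇒∣m+n n∣a-b n∣b-c))

  ≡mod-+ : ∀ {a b c d} → a ≡ b ⟨mod n ⟩ → c ≡ d ⟨mod n ⟩ → a ℤ.+ c ≡ b ℤ.+ d ⟨mod n ⟩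
  ≡mod-+ {a} {b} {c} {d} (mkCong n∣a-b) (mkCong n∣c-d) =
    mkCong (subst (+ n ℤ.∣_) (regroup a b c d) (ℤ.∣m∣n⇒∣m+n n∣a-b n∣c-d))
    where
    regroup : ∀ a b c d → (a ℤ.- b) ℤ.+ (c ℤ.- d) ≡ (a ℤ.+ c) ℤ.- (b ℤ.+ d)
    regroup = ℤ.solve-∀

  ≡mod-*ˡ : ∀ {a b} c → a ≡ b ⟨mod n ⟩ → c ℤ.* a ≡ c ℤ.* b ⟨mod n ⟩
  ≡mod-*ˡ {a} {b} c (mkCong n∣a-b) =
    mkCong (subst (+ n ℤ.∣_) (distrib c a b) (ℤ.∣n⇒∣m*n c n∣a-b))
    where
    distrib : ∀ c a b → c ℤ.* (a ℤ.- b) ≡ c ℤ.* a ℤ.- c ℤ.* b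
    distrib = ℤ.solve-∀

  ≡mod-* : ∀ {a b c d} → a ≡ b ⟨mod n ⟩ → c ≡ d ⟨mod n ⟩ → a ℤ.* c ≡ b ℤ.* d ⟨mod n ⟩
  ≡mod-* {a} {b} {c} {d} a≡b c≡d = ≡mod-trans (≡mod-*ˡ a c≡d)
    (subst₂ (_≡_⟨mod n ⟩) (ℤ.*-comm d a) (ℤ.*-comm d b) (≡mod-*ˡ d a≡b))

  ≡mod-neg : ∀ {a b} → a ≡ b ⟨mod n ⟩ → ℤ.- a ≡ ℤ.- b ⟨mod n ⟩
  ≡mod-neg {a} {b} a≡b =
    subst₂ (_≡_⟨mod n ⟩) (ℤ.-1*i≡-i a) (ℤ.-1*i≡-i b) (≡mod-*ˡ (ℤ.- + 1) a≡b)

  ≡mod-∣ : ∀ {a b d} → d ∣ n → a ≡ b ⟨mod n ⟩ → a ≡ b ⟨mod d ⟩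
  ≡mod-∣ d∣n (mkCong n∣a-b) = mkCong (ℤ.∣-trans (ℤ.∣ᵤ⇒∣ d∣n) n∣a-b)

  ≡mod-scale : ∀ {a b} c → a ≡ b ⟨mod n ⟩ → + c ℤ.* a ≡ + c ℤ.* b ⟨mod c * n ⟩
  ≡mod-scale {a} {b} c (mkCong (ℤ.divides q a-b≡qn)) = mkCong (ℤ.divides q (begin
    + c ℤ.* a ℤ.- + c ℤ.* b  ≡⟨ distrib (+ c) a b ⟩
    + c ℤ.* (a ℤ.- b)        ≡⟨ cong (+ c ℤ.*_) a-b≡qn ⟩
    + c ℤ.* (q ℤ.* + n)      ≡⟨ ℤ.*-comm (+ c) _ ⟩
    q ℤ.* + n ℤ.* + c        ≡⟨ ℤ.*-assoc q (+ n) (+ c) ⟩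
    q ℤ.* (+ n ℤ.* + c)      ≡⟨ cong (q ℤ.*_) (trans (sym (ℤ.pos-* n c)) (cong +_ (*-comm n c))) ⟩
    q ℤ.* + (c * n)          ∎))
    where
    open ≡-Reasoning
    distrib : ∀ c a b → c ℤ.* a ℤ.- c ℤ.* b ≡ c ℤ.* (a ℤ.- b)
    distrib = ℤ.solve-∀

  ≡mod-cancel : ∀ {a b c} → a ℤ.+ b ≡ + 0 ⟨mod n ⟩ → a ≡ c ⟨mod n ⟩ → b ≡ ℤ.- c ⟨mod n ⟩
  ≡mod-cancel {a} {b} {c} (mkCong n∣a+b) (mkCong n∣a-c) =
    mkCong (subst (+ n ℤ.∣_) (difference a b c) (ℤ.∣m∣n⇒∣m-n n∣a+b n∣a-c))
    where
    difference : ∀ a b c → (a ℤ.+ b ℤ.- + 0) ℤ.- (a ℤ.- c) ≡ b ℤ.- (ℤ.- c)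
    difference = ℤ.solve-∀

∣⊖∣≡∣-∣ : ∀ m n → ℤ.∣ m ℤ.⊖ n ∣ ≡ ∣ m - n ∣
∣⊖∣≡∣-∣ zero    zero    = refl
∣⊖∣≡∣-∣ zero    (suc n) = refl
∣⊖∣≡∣-∣ (suc m) zero    = refl
∣⊖∣≡∣-∣ (suc m) (suc n) = trans (cong ℤ.∣_∣ (ℤ.[1+m]⊖[1+n]≡m⊖n m n)) (∣⊖∣≡∣-∣ m n)

∣+m-+n∣≡∣m-n∣ : ∀ m n → ℤ.∣ + m ℤ.- + n ∣ ≡ ∣ m - n ∣
∣+m-+n∣≡∣m-n∣ m n = trans (cong ℤ.∣_∣ (ℤ.m-n≡m⊖n m n)) (∣⊖∣≡∣-∣ m n)

≡mod⇒≡[mod] : ∀ {a b n} → + a ≡ + b ⟨mod n ⟩ → a ≡ b [mod n ]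
≡mod⇒≡[mod] {a} {b} (mkCong n∣a-b) = subst (_ ∣_) (∣+m-+n∣≡∣m-n∣ a b) (ℤ.∣⇒∣ᵤ n∣a-b)

≡[mod]⇒≡mod : ∀ {a b n} → a ≡ b [mod n ] → + a ≡ + b ⟨mod n ⟩
≡[mod]⇒≡mod {a} {b} n∣∣a-b∣ = mkCong (ℤ.∣ᵤ⇒∣ (subst (_ ∣_) (sym (∣+m-+n∣≡∣m-n∣ a b)) n∣∣a-b∣))

∣⇒≡mod0 : ∀ {a n} → n ∣ a → + a ≡ + 0 ⟨mod n ⟩
∣⇒≡mod0 {a} n∣a = ≡[mod]⇒≡mod (subst (_ ∣_) (sym (∣-∣-identityʳ a)) n∣a)

≡mod0⇒∣ : ∀ {a n} → + a ≡ + 0 ⟨mod n ⟩ → n ∣ a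
≡mod0⇒∣ {a} a≡0 = subst (_ ∣_) (∣-∣-identityʳ a) (≡mod⇒≡[mod] a≡0)

+-multiple≡mod : ∀ {d} y {z} → d ∣ z → + (y + z) ≡ + y ⟨mod d ⟩
+-multiple≡mod y {z} d∣z =
  ≡[mod]⇒≡mod (subst (_ ∣_) (sym (trans (∣-∣-comm (y + z) y) (∣m-m+n∣≡n y z))) d∣z)

sumBelow : ℕ → (ℕ → ℕ) → ℕ
sumBelow zero    f = 0
sumBelow (suc n) f = sumBelow n f + f n

syntax sumBelow n (λ i → f) = ∑[ i < n ] f

∑-cong : ∀ {f g : ℕ → ℕ} n → (∀ i → i < n → f i ≡ g i) → ∑[ i < n ] f i ≡ ∑[ i < n ] g i
∑-cong zero    f≡g = refl
∑-cong {f} {g} (suc n) f≡g = cong₂ _+_ (∑-cong {f} {g} n (λ i i<n → f≡g i (m<n⇒m<1+n i<n))) (f≡g n ≤-refl)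

∑-≡mod : ∀ {f g : ℕ → ℕ} {d} n → (∀ i → i < n → + f i ≡ + g i ⟨mod d ⟩) →
         + (∑[ i < n ] f i) ≡ + (∑[ i < n ] g i) ⟨mod d ⟩
∑-≡mod zero    f≡g = ≡mod-refl
∑-≡mod {f} {g} (suc n) f≡g = ≡mod-+ (∑-≡mod {f} {g} n (λ i i<n → f≡g i (m<n⇒m<1+n i<n))) (f≡g n ≤-refl)

∑-∣ : ∀ {d} {f : ℕ → ℕ} n → (∀ i → i < n → d ∣ f i) → d ∣ ∑[ i < n ] f i
∑-∣ zero    d∣f = _ ∣0
∑-∣ {f = f} (suc n) d∣f = ∣m∣n⇒∣m+n (∑-∣ {f = f} n (λ i i<n → d∣f i (m<n⇒m<1+n i<n))) (d∣f n ≤-refl)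

∑-+ : ∀ (f g : ℕ → ℕ) n → ∑[ i < n ] (f i + g i) ≡ ∑[ i < n ] f i + ∑[ i < n ] g i
∑-+ f g zero    = refl
∑-+ f g (suc n) = trans (cong (_+ (f n + g n)) (∑-+ f g n)) (+-exchange (sumBelow n f) _ _ _)
  where
  +-exchange : ∀ a b c d → (a + b) + (c + d) ≡ (a + c) + (b + d)
  +-exchange = solve-∀

∑-*ˡ : ∀ c (f : ℕ → ℕ) n → ∑[ i < n ] (c * f i) ≡ c * ∑[ i < n ] f i
∑-*ˡ c f zero    = sym (*-zeroʳ c)
∑-*ˡ c f (suc n) = trans (cong (_+ c * f n) (∑-*ˡ c f n)) (sym (*-distribˡ-+ c (sumBelow n f) (f n)))

∑-const-1 : ∀ n → ∑[ i < n ] 1 ≡ n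
∑-const-1 zero    = refl
∑-const-1 (suc n) = trans (cong (_+ 1) (∑-const-1 n)) (+-comm n 1)

∑-peel : ∀ (f : ℕ → ℕ) n → ∑[ i < suc n ] f i ≡ f 0 + ∑[ i < n ] f (suc i)
∑-peel f zero    = +-comm 0 (f 0)
∑-peel f (suc n) = trans (cong (_+ f (suc n)) (∑-peel f n)) (+-assoc (f 0) _ _)

∑-split : ∀ (f : ℕ → ℕ) m n → ∑[ i < m + n ] f i ≡ ∑[ i < m ] f i + ∑[ i < n ] f (m + i)
∑-split f m zero    = trans (cong (λ k → sumBelow k f) (+-identityʳ m)) (sym (+-identityʳ _))
∑-split f m (suc n) = begin
  ∑[ i < m + suc n ] f i                               ≡⟨ cong (λ k → sumBelow k f) (+-suc m n) ⟩
  ∑[ i < m + n ] f i + f (m + n)                       ≡⟨ cong (_+ f (m + n)) (∑-split f m n) ⟩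
  ∑[ i < m ] f i + ∑[ i < n ] f (m + i) + f (m + n)    ≡⟨ +-assoc (sumBelow m f) _ _ ⟩
  ∑[ i < m ] f i + (∑[ i < n ] f (m + i) + f (m + n))  ∎
  where open ≡-Reasoning

S≡∑ : ∀ m n → S m n ≡ ∑[ i < n ] (suc i ^ m)
S≡∑ m zero    = refl
S≡∑ m (suc n) = cong (_+ suc n ^ m) (S≡∑ m n)

[1+k]*[1+n]C[1+k]≡[1+n]*nCk : ∀ n k → suc k * (suc n C suc k) ≡ suc n * (n C k)
[1+k]*[1+n]C[1+k]≡[1+n]*nCk zero    zero    = refl
[1+k]*[1+n]C[1+k]≡[1+n]*nCk zero    (suc k) = *-zeroʳ (suc (suc k))
[1+k]*[1+n]C[1+k]≡[1+n]*nCk (suc n) zero    =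
  trans (*-identityˡ _) (trans (nC1≡n (suc (suc n))) (sym (*-identityʳ _)))
[1+k]*[1+n]C[1+k]≡[1+n]*nCk (suc n) (suc k) = begin
  suc (suc k) * (suc (suc n) C suc (suc k))
    ≡⟨ cong (suc (suc k) *_) (sym (nCk+nC[k+1]≡[n+1]C[k+1] (suc n) (suc k))) ⟩
  suc (suc k) * (c₁ + c₂)
    ≡⟨ regroupˡ k c₁ c₂ ⟩
  suc k * c₁ + c₁ + suc (suc k) * c₂
    ≡⟨ cong₂ (λ x y → x + c₁ + y) ([1+k]*[1+n]C[1+k]≡[1+n]*nCk n k) ([1+k]*[1+n]C[1+k]≡[1+n]*nCk n (suc k)) ⟩
  suc n * (n C k) + c₁ + suc n * (n C suc k)
    ≡⟨ regroupʳ n c₁ (n C k) (n C suc k) ⟩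
  suc n * (n C k + n C suc k) + c₁
    ≡⟨ cong (λ x → suc n * x + c₁) (nCk+nC[k+1]≡[n+1]C[k+1] n k) ⟩
  suc n * c₁ + c₁
    ≡⟨ +-comm (suc n * c₁) c₁ ⟩
  suc (suc n) * c₁ ∎
  where
  open ≡-Reasoning
  c₁ = suc n C suc k
  c₂ = suc n C suc (suc k)
  regroupˡ : ∀ k x y → suc (suc k) * (x + y) ≡ suc k * x + x + suc (suc k) * y
  regroupˡ = solve-∀
  regroupʳ : ∀ n x a b → suc n * a + x + suc n * b ≡ suc n * (a + b) + x
  regroupʳ = solve-∀

prime∣pCk : ∀ {p k} → Prime p → 0 < k → k < p → p ∣ p C k
prime∣pCk {suc n} {suc k} p-prime _ k<p
  with euclidsLemma (suc k) (suc n C suc k) p-prime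
         (divides (n C k) (trans ([1+k]*[1+n]C[1+k]≡[1+n]*nCk n k) (*-comm (suc n) (n C k))))
... | inj₁ p∣k = contradiction (∣⇒≤ p∣k) (<⇒≱ k<p)
... | inj₂ p∣C = p∣C

i*iCr≡r*iCr+[1+r]*iC[1+r] : ∀ i r → i * (i C r) ≡ r * (i C r) + suc r * (i C suc r)
i*iCr≡r*iCr+[1+r]*iC[1+r] i r = +-cancelˡ-≡ (i C r) _ _ (begin
  i C r + i * (i C r)                            ≡⟨⟩
  suc i * (i C r)                                ≡⟨ [1+k]*[1+n]C[1+k]≡[1+n]*nCk i r ⟨
  suc r * (suc i C suc r)                        ≡⟨ cong (suc r *_) (nCk+nC[k+1]≡[n+1]C[k+1] i r) ⟨
  suc r * (i C r + i C suc r)                    ≡⟨ expand r (i C r) (i C suc r) ⟩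
  i C r + (r * (i C r) + suc r * (i C suc r))    ∎)
  where
  open ≡-Reasoning
  expand : ∀ r a b → suc r * (a + b) ≡ a + (r * a + suc r * b)
  expand = solve-∀

∑iCr≡nC[1+r] : ∀ r n → ∑[ i < n ] (i C r) ≡ n C suc r
∑iCr≡nC[1+r] r zero    = refl
∑iCr≡nC[1+r] r (suc n) = trans (cong (_+ n C r) (∑iCr≡nC[1+r] r n))
  (trans (+-comm (n C suc r) (n C r)) (nCk+nC[k+1]≡[n+1]C[k+1] n r))

binomial : ∀ a n → suc a ^ n ≡ ∑[ k < suc n ] ((n C k) * a ^ k)
binomial a zero    = refl
binomial a (suc n) = begin
  suc a * suc a ^ n                      ≡⟨ cong (suc a *_) (binomial a n) ⟩
  B + a * B                              ≡⟨ cong (_+ a * B) B≡1+T ⟩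
  1 + T + a * B                          ≡⟨ cong suc (+-comm T (a * B)) ⟩
  1 + (a * B + T)                        ≡⟨ cong suc (sym ∑G[1+k]≡a*B+T) ⟩
  1 + ∑[ k < suc n ] G (suc k)           ≡⟨ ∑-peel G (suc n) ⟨
  ∑[ k < suc (suc n) ] G k               ∎
  where
  open ≡-Reasoning
  g G : ℕ → ℕ
  g k = (n C k) * a ^ k
  G k = (suc n C k) * a ^ k
  B = ∑[ k < suc n ] g k
  T = ∑[ k < suc n ] g (suc k)
  g[1+n]≡0 : g (suc n) ≡ 0
  g[1+n]≡0 = cong (_* a ^ suc n) (k>n⇒nCk≡0 (n<1+n n))
  B≡1+T : B ≡ 1 + T
  B≡1+T = begin
    B                    ≡⟨ +-identityʳ B ⟨
    B + 0                ≡⟨ cong (_+_ B) g[1+n]≡0 ⟨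
    B + g (suc n)        ≡⟨ ∑-peel g (suc n) ⟩
    1 + T                ∎
  G[1+k]≡a*gk+g[1+k] : ∀ k → G (suc k) ≡ a * g k + g (suc k)
  G[1+k]≡a*gk+g[1+k] k = begin
    (suc n C suc k) * (a * a ^ k)              ≡⟨ cong (_* (a * a ^ k)) (nCk+nC[k+1]≡[n+1]C[k+1] n k) ⟨
    (n C k + n C suc k) * (a * a ^ k)          ≡⟨ expand a (a ^ k) (n C k) (n C suc k) ⟩
    a * ((n C k) * a ^ k) + (n C suc k) * (a * a ^ k) ∎
    where
    expand : ∀ a x c d → (c + d) * (a * x) ≡ a * (c * x) + d * (a * x)
    expand = solve-∀
  ∑G[1+k]≡a*B+T : ∑[ k < suc n ] G (suc k) ≡ a * B + T
  ∑G[1+k]≡a*B+T = begin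
    ∑[ k < suc n ] G (suc k)                          ≡⟨ ∑-cong (suc n) (λ k _ → G[1+k]≡a*gk+g[1+k] k) ⟩
    ∑[ k < suc n ] (a * g k + g (suc k))              ≡⟨ ∑-+ (λ k → a * g k) (λ k → g (suc k)) (suc n) ⟩
    ∑[ k < suc n ] (a * g k) + T                      ≡⟨ cong (_+ T) (∑-*ˡ a g (suc n)) ⟩
    a * B + T                                         ∎

-- Fermat's little theorem

prime>1 : ∀ {p} → Prime p → 1 < p
prime>1 {p} p-prime = nonTrivial⇒n>1 p {{prime⇒nonTrivial p-prime}}

[1+a]^p≡a^p+1 : ∀ {p} → Prime p → ∀ a → + (suc a ^ p) ≡ + (a ^ p + 1) ⟨mod p ⟩
[1+a]^p≡a^p+1 {zero}  p-prime a = contradiction (prime>1 p-prime) λ ()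
[1+a]^p≡a^p+1 {suc n} p-prime a =
  subst (λ x → + x ≡ + (a ^ suc n + 1) ⟨mod suc n ⟩) (sym expansion) (+-multiple≡mod (a ^ suc n + 1) p∣T)
  where
  open ≡-Reasoning
  G : ℕ → ℕ
  G k = (suc n C k) * a ^ k
  T = ∑[ k < n ] G (suc k)
  expansion : suc a ^ suc n ≡ a ^ suc n + 1 + T
  expansion = begin
    suc a ^ suc n                       ≡⟨ binomial a (suc n) ⟩
    ∑[ k < suc n ] G k + G (suc n)      ≡⟨ cong₂ _+_ (∑-peel G n) (cong (_* a ^ suc n) (nCn≡1 (suc n))) ⟩
    1 + T + 1 * a ^ suc n               ≡⟨ rearrange T (a ^ suc n) ⟩
    a ^ suc n + 1 + T                   ∎
    where
    rearrange : ∀ t x → 1 + t + 1 * x ≡ x + 1 + t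
    rearrange = solve-∀
  p∣T : suc n ∣ T
  p∣T = ∑-∣ n (λ k k<n → ∣m⇒∣m*n (a ^ suc k) (prime∣pCk p-prime z<s (s<s k<n)))

a^p≡a : ∀ {p} → Prime p → ∀ a → + (a ^ p) ≡ + a ⟨mod p ⟩
a^p≡a {zero}  p-prime a       = contradiction (prime>1 p-prime) λ ()
a^p≡a {suc n} p-prime zero    = ≡mod-refl
a^p≡a {suc n} p-prime (suc a) = ≡mod-trans ([1+a]^p≡a^p+1 p-prime a)
  (subst (λ x → + (a ^ suc n + 1) ≡ + x ⟨mod suc n ⟩) (+-comm a 1)
    (≡mod-+ (a^p≡a p-prime a) (≡mod-refl {a = + 1})))

a^[p-1]≡1 : ∀ {p a} → Prime p → ¬ p ∣ a → + (a ^ (p ∸ 1)) ≡ + 1 ⟨mod p ⟩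
a^[p-1]≡1 {zero}      p-prime _   = contradiction (prime>1 p-prime) λ ()
a^[p-1]≡1 {suc n} {a} p-prime p∤a = ≡[mod]⇒≡mod p∣∣a^n-1∣
  where
  p∣a*∣a^n-1∣ : suc n ∣ a * ∣ a ^ n - 1 ∣
  p∣a*∣a^n-1∣ = subst (suc n ∣_)
    (trans (cong (λ x → ∣ a * a ^ n - x ∣) (sym (*-identityʳ a))) (sym (*-distribˡ-∣-∣ a (a ^ n) 1)))
    (≡mod⇒≡[mod] (a^p≡a p-prime a))
  p∣∣a^n-1∣ : suc n ∣ ∣ a ^ n - 1 ∣
  p∣∣a^n-1∣ with euclidsLemma a _ p-prime p∣a*∣a^n-1∣
  ... | inj₁ p∣a = contradiction p∣a p∤a
  ... | inj₂ p∣∣a^n-1∣ = p∣∣a^n-1∣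

a^[t[p-1]+r]≡a^r : ∀ {p a} → Prime p → ¬ p ∣ a → ∀ t r → + (a ^ (t * (p ∸ 1) + r)) ≡ + (a ^ r) ⟨mod p ⟩
a^[t[p-1]+r]≡a^r p-prime p∤a zero    r = ≡mod-refl
a^[t[p-1]+r]≡a^r {p} {a} p-prime p∤a (suc t) r =
  subst₂ (_≡_⟨mod p ⟩) (cong +_ (sym split)) (ℤ.*-identityˡ (+ (a ^ r)))
    (subst (λ x → x ≡ + 1 ℤ.* + (a ^ r) ⟨mod p ⟩) (sym (ℤ.pos-* (a ^ (p ∸ 1)) (a ^ (t * (p ∸ 1) + r))))
      (≡mod-* (a^[p-1]≡1 p-prime p∤a) (a^[t[p-1]+r]≡a^r p-prime p∤a t r)))
  where
  split : a ^ (suc t * (p ∸ 1) + r) ≡ a ^ (p ∸ 1) * a ^ (t * (p ∸ 1) + r)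
  split = trans (cong (a ^_) (+-assoc (p ∸ 1) (t * (p ∸ 1)) r)) (^-distribˡ-+-* a (p ∸ 1) _)

-- Power sums modulo a prime

-- Σ_{i<p} i^j ≡ 0 (mod p) for 0 < j < p - 1, generalised in r so that induction on j goes through.
p∣∑i^j*iCr : ∀ {p} → Prime p → ∀ j r → 2 + r + j ≤ p → p ∣ ∑[ i < p ] (i ^ j * (i C r))
p∣∑i^j*iCr {p} p-prime zero r 2+r+0≤p =
  subst (p ∣_) (trans (sym (∑iCr≡nC[1+r] r p)) (∑-cong p (λ i _ → sym (*-identityˡ (i C r)))))
    (prime∣pCk p-prime z<s (subst (λ x → 2 + x ≤ p) (+-identityʳ r) 2+r+0≤p))
p∣∑i^j*iCr {p} p-prime (suc j) r 2+r+[1+j]≤p = subst (p ∣_) (sym split)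
  (∣m∣n⇒∣m+n (∣n⇒∣m*n r (p∣∑i^j*iCr p-prime j r (≤-trans (+-monoʳ-≤ (2 + r) (n≤1+n j)) 2+r+[1+j]≤p)))
              (∣n⇒∣m*n (suc r) (p∣∑i^j*iCr p-prime j (suc r) (subst (λ x → 2 + x ≤ p) (+-suc r j) 2+r+[1+j]≤p))))
  where
  open ≡-Reasoning
  f g : ℕ → ℕ
  f i = i ^ j * (i C r)
  g i = i ^ j * (i C suc r)
  pointwise : ∀ i → i ^ suc j * (i C r) ≡ r * f i + suc r * g i
  pointwise i = begin
    i * i ^ j * (i C r)                        ≡⟨ swap i (i ^ j) (i C r) ⟩
    i ^ j * (i * (i C r))                      ≡⟨ cong (i ^ j *_) (i*iCr≡r*iCr+[1+r]*iC[1+r] i r) ⟩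
    i ^ j * (r * (i C r) + suc r * (i C suc r)) ≡⟨ distrib (i ^ j) r (i C r) (i C suc r) ⟩
    r * f i + suc r * g i                      ∎
    where
    swap : ∀ a x c → a * x * c ≡ x * (a * c)
    swap = solve-∀
    distrib : ∀ x r c d → x * (r * c + suc r * d) ≡ r * (x * c) + suc r * (x * d)
    distrib = solve-∀
  split : ∑[ i < p ] (i ^ suc j * (i C r)) ≡ r * ∑[ i < p ] f i + suc r * ∑[ i < p ] g i
  split = begin
    ∑[ i < p ] (i ^ suc j * (i C r))                 ≡⟨ ∑-cong p (λ i _ → pointwise i) ⟩
    ∑[ i < p ] (r * f i + suc r * g i)               ≡⟨ ∑-+ (λ i → r * f i) (λ i → suc r * g i) p ⟩
    ∑[ i < p ] (r * f i) + ∑[ i < p ] (suc r * g i)  ≡⟨ cong₂ _+_ (∑-*ˡ r f p) (∑-*ˡ (suc r) g p) ⟩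
    r * ∑[ i < p ] f i + suc r * ∑[ i < p ] g i      ∎

S[k,p]≡-1 : ∀ {p k} .{{_ : NonZero k}} → Prime p → (p ∸ 1) ∣ k → + S k p ≡ ℤ.- + 1 ⟨mod p ⟩
S[k,p]≡-1 {zero}              p-prime _ = contradiction (prime>1 p-prime) λ ()
S[k,p]≡-1 {suc n} {k@(suc k′)} p-prime (divides t k≡tn) =
  subst (λ x → + x ≡ ℤ.- + 1 ⟨mod suc n ⟩) (sym (cong (_+ suc n ^ k) (S≡∑ k n)))
    (≡mod-trans (≡mod-+ ∑≡n p^k≡0) n≡-1)
  where
  ∑≡n : + (∑[ i < n ] (suc i ^ k)) ≡ + n ⟨mod suc n ⟩
  ∑≡n = subst (λ x → + (∑[ i < n ] (suc i ^ k)) ≡ + x ⟨mod suc n ⟩) (∑-const-1 n)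
    (∑-≡mod n (λ i i<n → subst (λ e → + (suc i ^ e) ≡ + 1 ⟨mod suc n ⟩)
      (sym (trans k≡tn (sym (+-identityʳ (t * n)))))
      (a^[t[p-1]+r]≡a^r p-prime (>⇒∤ (s<s i<n)) t 0)))
  p^k≡0 : + (suc n ^ k) ≡ + 0 ⟨mod suc n ⟩
  p^k≡0 = ∣⇒≡mod0 (m∣m*n (suc n ^ k′))
  n≡-1 : + n ℤ.+ + 0 ≡ ℤ.- + 1 ⟨mod suc n ⟩
  n≡-1 = mkCong (ℤ.divides (+ 1) (trans (difference (+ n)) (cong (λ x → + 1 ℤ.* + x) (+-comm n 1))))
    where
    difference : ∀ x → (x ℤ.+ + 0) ℤ.- (ℤ.- + 1) ≡ + 1 ℤ.* (x ℤ.+ + 1)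
    difference = ℤ.solve-∀

S[k,p]≡0 : ∀ {p k} .{{_ : NonZero k}} → Prime p → ¬ (p ∸ 1) ∣ k → + S k p ≡ + 0 ⟨mod p ⟩
S[k,p]≡0 {zero}        p-prime _ = contradiction (prime>1 p-prime) λ ()
S[k,p]≡0 {suc zero}    p-prime _ = contradiction (prime>1 p-prime) (<-irrefl refl)
S[k,p]≡0 {suc (suc n)} {k@(suc k′)} p-prime p-1∤k with k % suc n in k%d≡r
... | zero   = contradiction (divides (k / suc n)
                 (trans (m≡m%n+[m/n]*n k (suc n)) (cong (_+ (k / suc n) * suc n) k%d≡r))) p-1∤k
... | suc r′ =
  subst (λ x → + x ≡ + 0 ⟨mod p ⟩) (sym (cong (_+ p ^ k) (S≡∑ k (suc n))))
    (≡mod-+ ∑≡0 (∣⇒≡mod0 (m∣m*n (p ^ k′))))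
  where
  p = suc (suc n)
  r = suc r′
  k≡qd+r : k ≡ (k / suc n) * suc n + r
  k≡qd+r = trans (m≡m%n+[m/n]*n k (suc n)) (trans (cong (_+ (k / suc n) * suc n) k%d≡r) (+-comm r ((k / suc n) * suc n)))
  2+r≤p : 2 + r ≤ p
  2+r≤p = s≤s (subst (_< suc n) k%d≡r (m%n<n k (suc n)))
  p∣∑i^r : p ∣ ∑[ i < suc n ] (suc i ^ r)
  p∣∑i^r = subst (p ∣_)
    (trans (∑-peel _ (suc n)) (∑-cong (suc n) (λ i _ → *-identityʳ (suc i ^ r))))
    (p∣∑i^j*iCr p-prime r 0 2+r≤p)
  ∑≡0 : + (∑[ i < suc n ] (suc i ^ k)) ≡ + 0 ⟨mod p ⟩
  ∑≡0 = ≡mod-trans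
    (∑-≡mod (suc n) (λ i i<d → subst (λ e → + (suc i ^ e) ≡ + (suc i ^ r) ⟨mod p ⟩) (sym k≡qd+r)
      (a^[t[p-1]+r]≡a^r p-prime (>⇒∤ (s<s i<d)) (k / suc n) r)))
    (∣⇒≡mod0 p∣∑i^r)

-- Power sums modulo prime powers

[a+b]^[1+k]-expansion : ∀ a b k → ∃[ X ] (a + b) ^ suc k ≡ a ^ suc k + (suc k * a ^ k * b + b * b * X)
[a+b]^[1+k]-expansion a b zero    = 0 , step a b
  where
  step : ∀ a b → (a + b) * 1 ≡ a * 1 + (1 * 1 * b + b * b * 0)
  step = solve-∀
[a+b]^[1+k]-expansion a b (suc k) with [a+b]^[1+k]-expansion a b k
... | X , eq = a * X + suc k * a ^ k + b * X , trans (cong ((a + b) *_) eq) (step a b k (a ^ k) X)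
  where
  step : ∀ a b k y X → (a + b) * (a * y + (suc k * y * b + b * b * X))
           ≡ a * (a * y) + (suc (suc k) * (a * y) * b + b * b * (a * X + suc k * y + b * X))
  step = solve-∀

[a+b]^k≡a^k : ∀ {p} a b k → p ∣ k → p ∣ b → + ((a + b) ^ k) ≡ + (a ^ k) ⟨mod b * p ⟩
[a+b]^k≡a^k a b zero _ _ = ≡mod-refl
[a+b]^k≡a^k {p} a b (suc k) (divides c 1+k≡cp) (divides d b≡dp) with [a+b]^[1+k]-expansion a b k
... | X , eq = subst (λ x → + x ≡ + (a ^ suc k) ⟨mod b * p ⟩) (sym eq) (+-multiple≡mod (a ^ suc k)
      (∣m∣n⇒∣m+n (divides (c * a ^ k) (trans (cong (λ x → x * a ^ k * b) 1+k≡cp) (regroup₁ c p (a ^ k) b)))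
                 (divides (d * X) (trans (cong (λ x → b * x * X) b≡dp) (regroup₂ b d p X)))))
  where
  regroup₁ : ∀ c p y b → c * p * y * b ≡ c * y * (b * p)
  regroup₁ = solve-∀
  regroup₂ : ∀ b d p X → b * (d * p) * X ≡ d * X * (b * p)
  regroup₂ = solve-∀

∑-periodic : ∀ (f : ℕ → ℕ) N {M} → (∀ a → + f (N + a) ≡ + f a ⟨mod M ⟩) →
             ∀ c → + (∑[ i < c * N ] f i) ≡ + (c * ∑[ i < N ] f i) ⟨mod M ⟩
∑-periodic f N f-periodic zero    = ≡mod-refl
∑-periodic f N f-periodic (suc c) =
  subst (λ x → + x ≡ + (suc c * ∑[ i < N ] f i) ⟨mod _ ⟩) (sym (∑-split f N (c * N)))
    (≡mod-+ (≡mod-refl {a = + (∑[ i < N ] f i)})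
      (≡mod-trans (∑-≡mod (c * N) (λ i _ → f-periodic i)) (∑-periodic f N f-periodic c)))

S[k,c*N]≡c*S[k,N] : ∀ {p k N} → p ∣ k → p ∣ N → ∀ c → + S k (c * N) ≡ + (c * S k N) ⟨mod N * p ⟩
S[k,c*N]≡c*S[k,N] {p} {k} {N} p∣k p∣N c =
  subst₂ (λ x y → + x ≡ + (c * y) ⟨mod N * p ⟩) (sym (S≡∑ k (c * N))) (sym (S≡∑ k N))
    (∑-periodic (λ i → suc i ^ k) N shift c)
  where
  shift : ∀ a → + (suc (N + a) ^ k) ≡ + (suc a ^ k) ⟨mod N * p ⟩
  shift a = subst (λ x → + (x ^ k) ≡ + (suc a ^ k) ⟨mod N * p ⟩)
    (trans (+-comm (suc a) N) (+-suc N a)) ([a+b]^k≡a^k (suc a) N k p∣k p∣N)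

S[k,p^[1+e]]≡p^e*S[k,p] : ∀ {p k} → p ∣ k → ∀ e → + S k (p ^ suc e) ≡ + (p ^ e * S k p) ⟨mod p ^ suc e ⟩
S[k,p^[1+e]]≡p^e*S[k,p] {p} {k} p∣k zero =
  subst₂ (λ n s → + S k n ≡ + s ⟨mod n ⟩) (sym (*-identityʳ p)) (sym (*-identityˡ (S k p))) ≡mod-refl
S[k,p^[1+e]]≡p^e*S[k,p] {p} {k} p∣k (suc e) = ≡mod-trans
  (subst (λ n → + S k (p * p ^ suc e) ≡ + (p * S k (p ^ suc e)) ⟨mod n ⟩) (*-comm (p ^ suc e) p)
    (S[k,c*N]≡c*S[k,N] p∣k (m∣m*n (p ^ e)) p))
  (subst₂ (_≡_⟨mod p * p ^ suc e ⟩) (sym (ℤ.pos-* p (S k (p ^ suc e))))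
    (trans (sym (ℤ.pos-* p (p ^ e * S k p))) (cong +_ (sym (*-assoc p (p ^ e) (S k p)))))
    (≡mod-scale p (S[k,p^[1+e]]≡p^e*S[k,p] p∣k e)))

S[k,k]≡c*p^e*S[k,p] : ∀ {p k c e v} → k ≡ c * p ^ suc e → + S k p ≡ v ⟨mod p ⟩ →
                      + S k k ≡ + (c * p ^ e) ℤ.* v ⟨mod p ^ suc e ⟩
S[k,k]≡c*p^e*S[k,p] {p} {k} {c} {e} {v} k≡cp^[1+e] S[k,p]≡v = ≡mod-trans (≡mod-trans reduce lift) fold
  where
  N = p ^ suc e
  p∣k : p ∣ k
  p∣k = divides (c * p ^ e) (trans k≡cp^[1+e] (regroup c p (p ^ e)))
    where
    regroup : ∀ c p y → c * (p * y) ≡ c * y * p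
    regroup = solve-∀
  reduce : + S k k ≡ + (c * S k N) ⟨mod N ⟩
  reduce = subst (λ x → + S k x ≡ + (c * S k N) ⟨mod N ⟩) (sym k≡cp^[1+e])
    (≡mod-∣ (m∣m*n p) (S[k,c*N]≡c*S[k,N] p∣k (m∣m*n (p ^ e)) c))
  lift : + (c * S k N) ≡ + (c * p ^ e) ℤ.* + S k p ⟨mod N ⟩
  lift = subst₂ (_≡_⟨mod N ⟩) (sym (ℤ.pos-* c (S k N)))
    (trans (sym (ℤ.pos-* c (p ^ e * S k p))) (trans (cong +_ (sym (*-assoc c (p ^ e) (S k p)))) (ℤ.pos-* (c * p ^ e) (S k p))))
    (≡mod-*ˡ (+ c) (S[k,p^[1+e]]≡p^e*S[k,p] p∣k e))
  fold : + (c * p ^ e) ℤ.* + S k p ≡ + (c * p ^ e) ℤ.* v ⟨mod N ⟩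
  fold = ≡mod-∣ (divides c (regroup c p (p ^ e))) (≡mod-scale (c * p ^ e) S[k,p]≡v)
    where
    regroup : ∀ c p y → c * y * p ≡ c * (p * y)
    regroup = solve-∀

prime⇒0<p : ∀ {p} → Prime p → 0 < p
prime⇒0<p p-prime = <-trans z<s (prime>1 p-prime)

m*n>0⇒m>0 : ∀ m {n} → 0 < m * n → 0 < m
m*n>0⇒m>0 (suc _) _ = z<s

m*n>0⇒n>0 : ∀ m {n} → 0 < m * n → 0 < n
m*n>0⇒n>0 m {n} 0<mn = m*n>0⇒m>0 n (subst (0 <_) (*-comm m n) 0<mn)

∃prime∣ : ∀ {n} → 1 < n → ∃[ p ] (Prime p × p ∣ n)
∃prime∣ {suc zero} (s<s ())
∃prime∣ {n@(suc (suc _))} _ with factorise n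
... | record { factors = [] ; isFactorisation = () }
... | record { factors = p ∷ ps ; isFactorisation = n≡p*Πps ; factorsPrime = p-prime All.∷ _ } =
  p , p-prime , divides (product ps) (trans n≡p*Πps (*-comm p _))

p^n∣m*o⇒p^n∣o : ∀ {p m} → Prime p → ¬ p ∣ m → ∀ n {o} → p ^ n ∣ m * o → p ^ n ∣ o
p^n∣m*o⇒p^n∣o p-prime p∤m zero    _ = 1∣ _
p^n∣m*o⇒p^n∣o {p} {m} p-prime p∤m (suc n) {o} p^[1+n]∣mo
  with euclidsLemma m o p-prime (∣-trans (m∣m*n (p ^ n)) p^[1+n]∣mo)
... | inj₁ p∣m = contradiction p∣m p∤m
... | inj₂ (divides o′ refl) = subst (p ^ suc n ∣_) (*-comm p o′)
  (*-monoʳ-∣ p (p^n∣m*o⇒p^n∣o p-prime p∤m n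
    (*-cancelˡ-∣ p {{>-nonZero (prime⇒0<p p-prime)}} (subst (p * p ^ n ∣_) (regroup m o′ p) p^[1+n]∣mo))))
  where
  regroup : ∀ m o p → m * (o * p) ≡ p * (m * o)
  regroup = solve-∀

prime-power-split : ∀ {p} → Prime p → ∀ k → 0 < k → p ∣ k → ∃[ e ] ∃[ r ] (k ≡ p ^ suc e * r × ¬ p ∣ r)
prime-power-split {p} p-prime = <-rec _ split
  where
  split : ∀ k → (∀ {j} → j < k → 0 < j → p ∣ j → ∃[ e ] ∃[ r ] (j ≡ p ^ suc e * r × ¬ p ∣ r)) →
          0 < k → p ∣ k → ∃[ e ] ∃[ r ] (k ≡ p ^ suc e * r × ¬ p ∣ r)
  split k rec 0<k (divides q k≡qp) with p ∣? q
  ... | no p∤q = 0 , q , trans k≡qp (trans (*-comm q p) (cong (_* q) (sym (*-identityʳ p)))) , p∤q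
  ... | yes p∣q with rec q<k 0<q p∣q
    where
    0<q : 0 < q
    0<q = m*n>0⇒m>0 q (subst (0 <_) k≡qp 0<k)
    q<k : q < k
    q<k = subst (q <_) (sym k≡qp) (m<m*n q p {{>-nonZero 0<q}} (prime>1 p-prime))
  ... | e , r , q≡p^[1+e]r , p∤r =
    suc e , r , trans k≡qp (trans (cong (_* p) q≡p^[1+e]r) (regroup (p ^ suc e) r p)) , p∤r
    where
    regroup : ∀ x r p → x * r * p ≡ (p * x) * r
    regroup = solve-∀

coprime∧∣⇒*∣ : ∀ {m n o} → Coprime m n → m ∣ o → n ∣ o → m * n ∣ o
coprime∧∣⇒*∣ {m} {n} m⊥n (divides z o≡zm) n∣o
  with coprime-divisor (Coprime.sym m⊥n) (subst (n ∣_) (trans o≡zm (*-comm z m)) n∣o)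
... | divides w z≡wn = divides w (trans o≡zm (trans (cong (_* m) z≡wn) (regroup w n m)))
  where
  regroup : ∀ w n m → w * n * m ≡ w * (m * n)
  regroup = solve-∀

∣-from-prime-powers : ∀ {k y} → 0 < k → (∀ {p} e → Prime p → p ^ suc e ∣ k → p ^ suc e ∣ y) → k ∣ y
∣-from-prime-powers {k} {y} = <-rec _ assemble k
  where
  assemble : ∀ k → (∀ {j} → j < k → 0 < j → (∀ {p} e → Prime p → p ^ suc e ∣ j → p ^ suc e ∣ y) → j ∣ y) →
             0 < k → (∀ {p} e → Prime p → p ^ suc e ∣ k → p ^ suc e ∣ y) → k ∣ y
  assemble (suc zero)    rec _   _     = 1∣ y
  assemble k@(suc (suc _)) rec 0<k local with ∃prime∣ {k} (s<s z<s)
  ... | p , p-prime , p∣k with prime-power-split p-prime k 0<k p∣k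
  ... | e , r , k≡p^[1+e]r , p∤r = subst (_∣ y) (sym k≡p^[1+e]r) p^[1+e]r∣y
    where
    0<r : 0 < r
    0<r = m*n>0⇒n>0 (p ^ suc e) (subst (0 <_) k≡p^[1+e]r 0<k)
    r<k : r < k
    r<k = subst (r <_) (trans (*-comm r _) (sym k≡p^[1+e]r))
      (m<m*n r (p ^ suc e) {{>-nonZero 0<r}} (^-monoʳ-< p (prime>1 p-prime) (z<s {e})))
    r∣k : r ∣ k
    r∣k = divides (p ^ suc e) k≡p^[1+e]r
    p^[1+e]r∣y : p ^ suc e * r ∣ y
    p^[1+e]r∣y with rec r<k 0<r (λ f q-prime q^[1+f]∣r → local f q-prime (∣-trans q^[1+f]∣r r∣k))
    ... | divides w refl = *-monoˡ-∣ r (p^n∣m*o⇒p^n∣o p-prime p∤r (suc e)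
      (subst (p ^ suc e ∣_) (*-comm w r) (local e p-prime (divides r (trans k≡p^[1+e]r (*-comm _ r))))))

div≡/ : ∀ a b .{{_ : NonZero b}} → a div b ≡ a / b
div≡/ a (suc b) = refl

div*≡ : ∀ {a b} .{{_ : NonZero b}} → b ∣ a → a div b * b ≡ a
div*≡ {a} {b} b∣a = trans (cong (_* b) (div≡/ a b)) (m/n*n≡m b∣a)

div>0 : ∀ {a b} .{{_ : NonZero b}} → b ∣ a → 0 < a → 0 < a div b
div>0 {a} {b} b∣a 0<a = subst (0 <_) (sym (div≡/ a b)) (m≥n⇒m/n>0 (∣⇒≤ {{>-nonZero 0<a}} b∣a))

gcd>0 : ∀ m {n} → 0 < n → 0 < gcd m n
gcd>0 m {n} 0<n = n≢0⇒n>0 (λ gcd≡0 → <⇒≢ 0<n (sym (gcd[m,n]≡0⇒n≡0 m gcd≡0)))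

∈primeDivisors⁺ : ∀ {Q q} → 0 < Q → Prime q → q ∣ Q → q ∈ primeDivisors Q
∈primeDivisors⁺ {suc Q} _ q-prime q∣Q =
  ∈-filter⁺ (λ p → prime? p ×-dec p ∣? suc Q) (∈-upTo⁺ (s≤s (∣⇒≤ q∣Q))) (q-prime , q∣Q)

∈primeDivisors⁻ : ∀ {Q q} → q ∈ primeDivisors Q → Prime q × q ∣ Q
∈primeDivisors⁻ {Q} q∈ = proj₂ (∈-filter⁻ (λ p → prime? p ×-dec p ∣? Q) {xs = upTo (suc Q)} q∈)

primeDivisors-unique : ∀ Q → Unique (primeDivisors Q)
primeDivisors-unique Q = Unique.filter⁺ (λ p → prime? p ×-dec p ∣? Q) (Unique.upTo⁺ (suc Q))

∈⇒∣lcmList : ∀ {x} xs → x ∈ xs → x ∣ lcmList xs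
∈⇒∣lcmList (y ∷ xs) (here refl) = m∣lcm[m,n] y (lcmList xs)
∈⇒∣lcmList (y ∷ xs) (there x∈) = ∣-trans (∈⇒∣lcmList xs x∈) (n∣lcm[m,n] y (lcmList xs))

lcm>0 : ∀ {m n} → 0 < m → 0 < n → 0 < lcm m n
lcm>0 {m} {n} 0<m 0<n = m*n>0⇒n>0 (gcd m n)
  (subst (0 <_) (sym (gcd*lcm m n)) (*-mono-< 0<m 0<n))

lcmList>0 : ∀ xs → (∀ {x} → x ∈ xs → 0 < x) → 0 < lcmList xs
lcmList>0 []       _     = z<s
lcmList>0 (x ∷ xs) xs>0 = lcm>0 (xs>0 (here refl)) (lcmList>0 xs (λ x∈ → xs>0 (there x∈)))

primeDivisors[1]-empty : ∀ {q} → ¬ q ∈ primeDivisors 1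
primeDivisors[1]-empty q∈ with ∈primeDivisors⁻ {1} q∈
... | q-prime , q∣1 = <⇒≢ (prime>1 q-prime) (sym (∣1⇒≡1 q∣1))

𝔫-term : ℕ → ℕ → ℕ
𝔫-term Q q = (q ∸ 1) div gcd (q ∸ 1) Q

𝔫-term∣𝔫 : ∀ {Q q} → q ∈ primeDivisors Q → 𝔫-term Q q ∣ 𝔫 Q
𝔫-term∣𝔫 {zero}            q∈ = ∈⇒∣lcmList (map (𝔫-term 0) (primeDivisors 0)) (∈-map⁺ (𝔫-term 0) q∈)
𝔫-term∣𝔫 {suc zero}        q∈ = contradiction q∈ primeDivisors[1]-empty
𝔫-term∣𝔫 {Q@(suc (suc _))} q∈ = ∈⇒∣lcmList (map (𝔫-term Q) (primeDivisors Q)) (∈-map⁺ (𝔫-term Q) q∈)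

𝔫>0 : ∀ {Q} → 0 < Q → 0 < 𝔫 Q
𝔫>0 {suc zero}      _   = z<s
𝔫>0 {Q@(suc (suc _))} 0<Q = lcmList>0 (map (𝔫-term Q) (primeDivisors Q)) λ x∈ → case ∈-map⁻ (𝔫-term Q) x∈ of λ where
  (q , q∈ , refl) → div>0 {{>-nonZero (gcd>0 (q ∸ 1) 0<Q)}} (gcd[m,n]∣m (q ∸ 1) Q)
                      (m<n⇒0<n∸m (prime>1 (proj₁ (∈primeDivisors⁻ {Q} q∈))))

q-1∣Q*𝔫 : ∀ {Q q} → 0 < Q → q ∈ primeDivisors Q → (q ∸ 1) ∣ Q * 𝔫 Q
q-1∣Q*𝔫 {Q} {q} 0<Q q∈ = subst (_∣ Q * 𝔫 Q)
  (trans (*-comm (gcd (q ∸ 1) Q) _) (div*≡ {{>-nonZero (gcd>0 (q ∸ 1) 0<Q)}} (gcd[m,n]∣m (q ∸ 1) Q)))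
  (*-pres-∣ (gcd[m,n]∣n (q ∸ 1) Q) (𝔫-term∣𝔫 {Q} q∈))

S[k,k]≡-c*p^e : ∀ {p k c e} .{{_ : NonZero k}} → Prime p → (p ∸ 1) ∣ k → k ≡ c * p ^ suc e →
                + S k k ≡ ℤ.- + (c * p ^ e) ⟨mod p ^ suc e ⟩
S[k,k]≡-c*p^e {p} {k} {c} {e} p-prime p-1∣k k≡cp^[1+e] =
  subst (λ x → + S k k ≡ x ⟨mod p ^ suc e ⟩)
    (trans (sym (ℤ.neg-distribʳ-* (+ (c * p ^ e)) (+ 1))) (cong ℤ.-_ (ℤ.*-identityʳ _)))
    (S[k,k]≡c*p^e*S[k,p] {c = c} {e = e} k≡cp^[1+e] (S[k,p]≡-1 p-prime p-1∣k))

S[k,k]≡0 : ∀ {p k c e} .{{_ : NonZero k}} → Prime p → ¬ (p ∸ 1) ∣ k → k ≡ c * p ^ suc e →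
           + S k k ≡ + 0 ⟨mod p ^ suc e ⟩
S[k,k]≡0 {p} {k} {c} {e} p-prime p-1∤k k≡cp^[1+e] =
  subst (λ x → + S k k ≡ x ⟨mod p ^ suc e ⟩) (ℤ.*-zeroʳ (+ (c * p ^ e)))
    (S[k,k]≡c*p^e*S[k,p] {c = c} {e = e} k≡cp^[1+e] (S[k,p]≡0 p-prime p-1∤k))

-- Obstructing primes

ObstructingPrime : ℕ → ℕ → ℕ → Set
ObstructingPrime Q m p = Prime p × ¬ p ∣ Q × p ∣ m × (p ∸ 1) ∣ Q * m

obstruction? : ∀ Q {m} → 0 < m → Dec (∃[ p ] ObstructingPrime Q m p)
obstruction? Q {m} 0<m = map′ satisfied search (any? obstructs? (upTo (suc m)))
  where
  obstructs? : ∀ p → Dec (ObstructingPrime Q m p)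
  obstructs? p = prime? p ×-dec ¬? (p ∣? Q) ×-dec p ∣? m ×-dec (p ∸ 1) ∣? Q * m
  search : ∃[ p ] ObstructingPrime Q m p → Any (ObstructingPrime Q m) (upTo (suc m))
  search (p , obstructs@(_ , _ , p∣m , _)) = lose (∈-upTo⁺ (s≤s (∣⇒≤ {{>-nonZero 0<m}} p∣m))) obstructs

n<m^n : ∀ {m} → 1 < m → ∀ n → n < m ^ n
n<m^n 1<m zero    = z<s
n<m^n {m} 1<m (suc n) = begin-strict
  suc n          ≡⟨ +-comm 1 n ⟩
  n + 1          <⟨ +-monoˡ-< 1 ih ⟩
  m ^ n + 1      ≤⟨ +-monoʳ-≤ (m ^ n) (≤-trans (s≤s z≤n) ih) ⟩
  m ^ n + m ^ n  ≡⟨ cong (_+_ (m ^ n)) (sym (+-identityʳ (m ^ n))) ⟩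
  2 * m ^ n      ≤⟨ *-monoˡ-≤ (m ^ n) 1<m ⟩
  m * m ^ n      ∎
  where
  open ≤-Reasoning
  ih : n < m ^ n
  ih = n<m^n 1<m n

obstruction⇒¬𝔑 : ∀ {Q m p} → 0 < Q → ObstructingPrime Q m p → ¬ 𝔑 Q m
obstruction⇒¬𝔑 {Q} {m} {p} 0<Q (p-prime , p∤Q , p∣m , p-1∣k) (0<m , S≡m) =
  <⇒≱ (<-trans (n<1+n k) (n<m^n (prime>1 p-prime) (suc k))) (∣⇒≤ (p^[1+e]∣k k))
  where
  k = Q * m
  instance
    k≢0 : NonZero k
    k≢0 = >-nonZero (*-mono-< 0<Q 0<m)
  -- Modulo p^(e+1) ∣ k both S_k(k) ≡ -c p^e and S_k(k) ≡ m ≡ 0 hold, so p ∣ c.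
  p^[1+e]∣k : ∀ e → p ^ suc e ∣ k
  p^[1+e]∣k zero    = subst (_∣ k) (sym (*-identityʳ p)) (∣-trans p∣m (n∣m*n Q))
  p^[1+e]∣k (suc e) with p^[1+e]∣k e
  ... | divides c k≡cp^[1+e] = divides (quotient p∣c)
    (trans k≡cp^[1+e] (trans (cong (_* p ^ suc e) (m∣n⇒n≡quotient*m p∣c)) (*-assoc (quotient p∣c) p _)))
    where
    p^[1+e]∣m : p ^ suc e ∣ m
    p^[1+e]∣m = p^n∣m*o⇒p^n∣o p-prime p∤Q (suc e) (divides c k≡cp^[1+e])
    -cp^e≡0 : ℤ.- + (c * p ^ e) ≡ + 0 ⟨mod p ^ suc e ⟩
    -cp^e≡0 = ≡mod-trans (≡mod-sym (S[k,k]≡-c*p^e {c = c} {e = e} p-prime p-1∣k k≡cp^[1+e]))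
      (≡mod-trans (≡mod-∣ (divides c k≡cp^[1+e]) (≡[mod]⇒≡mod S≡m)) (∣⇒≡mod0 p^[1+e]∣m))
    p∣c : p ∣ c
    p∣c = *-cancelʳ-∣ (p ^ e) {{m^n≢0 p e {{>-nonZero (prime⇒0<p p-prime)}}}}
      (≡mod0⇒∣ (subst₂ (_≡_⟨mod p ^ suc e ⟩) (ℤ.neg-involutive _) refl (≡mod-neg -cp^e≡0)))

m*sum≡m*f[p] : ∀ {P m p} (f : ℕ → ℕ) {xs} → Unique xs → p ∈ xs → (∀ {q} → q ∈ xs → q ≢ p → P ∣ m * f q) →
               + (m * sum (map f xs)) ≡ + (m * f p) ⟨mod P ⟩
m*sum≡m*f[p] {P} {m} {p} f {q ∷ xs} (q∉xs ∷ xs-unique) p∈ others-vanish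
  with q ≟ p | p∈
... | yes refl | _ = subst₂ (_≡_⟨mod P ⟩) (cong +_ (sym (*-distribˡ-+ m (f q) _))) (ℤ.+-identityʳ _)
  (≡mod-+ (≡mod-refl {a = + (m * f q)}) (∣⇒≡mod0 (rest-vanishes xs (λ q′∈ → others-vanish (there q′∈) (λ { refl → All.lookup q∉xs q′∈ refl })))))
  where
  rest-vanishes : ∀ ys → (∀ {q} → q ∈ ys → P ∣ m * f q) → P ∣ m * sum (map f ys)
  rest-vanishes []       _      = subst (P ∣_) (sym (*-zeroʳ m)) (P ∣0)
  rest-vanishes (y ∷ ys) ys-vanish = subst (P ∣_) (sym (*-distribˡ-+ m (f y) _))
    (∣m∣n⇒∣m+n (ys-vanish (here refl)) (rest-vanishes ys (λ y∈ → ys-vanish (there y∈))))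
... | no q≢p | here p≡q = contradiction (sym p≡q) q≢p
... | no q≢p | there p∈xs = subst₂ (_≡_⟨mod P ⟩) (cong +_ (sym (*-distribˡ-+ m (f q) _))) (ℤ.+-identityˡ _)
  (≡mod-+ (∣⇒≡mod0 (others-vanish (here refl) q≢p))
    (m*sum≡m*f[p] {m = m} f xs-unique p∈xs (λ q′∈ → others-vanish (there q′∈))))

-- Q m ∣ m (Σ_{q ∣ Q} Q/q + 1), and modulo p^(e+1) only the summand for q = p survives.
WPP⇒m≡-c*p^e : ∀ {Q m p c e} → WeakPrimaryPseudoperfect Q → Prime p → p ∣ Q → Q * m ≡ c * p ^ suc e →
               + m ≡ ℤ.- + (c * p ^ e) ⟨mod p ^ suc e ⟩
WPP⇒m≡-c*p^e {Q} {m} {p} {c} {e} (0<Q , Q∣∣Σ+1-0∣) p-prime p∣Q Qm≡cp^[1+e] =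
  ≡mod-cancel (∣⇒≡mod0 P∣mΣ+m) (subst (λ x → + (m * Σ) ≡ + x ⟨mod P ⟩) m[Q/p]≡cp^e mΣ≡m[Q/p])
  where
  P = p ^ suc e
  Σ = sum (map (Q div_) (primeDivisors Q))
  P∣Qm : P ∣ Q * m
  P∣Qm = divides c Qm≡cp^[1+e]
  0<p : 0 < p
  0<p = prime⇒0<p p-prime
  P∣mΣ+m : P ∣ m * Σ + m
  P∣mΣ+m = ∣-trans P∣Qm (subst (Q * m ∣_) (expand Σ m)
    (*-monoˡ-∣ m (subst (Q ∣_) (∣-∣-identityʳ (Σ + 1)) Q∣∣Σ+1-0∣)))
    where
    expand : ∀ s m → (s + 1) * m ≡ m * s + m
    expand = solve-∀
  P∣m[Q/q] : ∀ {q} → q ∈ primeDivisors Q → q ≢ p → P ∣ m * (Q div q)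
  P∣m[Q/q] {q} q∈ q≢p with ∈primeDivisors⁻ {Q} q∈
  ... | q-prime , q∣Q = p^n∣m*o⇒p^n∣o p-prime p∤q (suc e)
    (subst (P ∣_) (trans (cong (_* m) (sym (div*≡ {{>-nonZero (prime⇒0<p q-prime)}} q∣Q))) (regroup (Q div q) q m)) P∣Qm)
    where
    p∤q : ¬ p ∣ q
    p∤q p∣q with prime⇒irreducible q-prime p∣q
    ... | inj₁ p≡1 = <⇒≢ (prime>1 p-prime) (sym p≡1)
    ... | inj₂ p≡q = q≢p (sym p≡q)
    regroup : ∀ x q m → x * q * m ≡ q * (m * x)
    regroup = solve-∀
  mΣ≡m[Q/p] : + (m * Σ) ≡ + (m * (Q div p)) ⟨mod P ⟩
  mΣ≡m[Q/p] = m*sum≡m*f[p] {m = m} (Q div_) (primeDivisors-unique Q) (∈primeDivisors⁺ 0<Q p-prime p∣Q) P∣m[Q/q]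
  m[Q/p]≡cp^e : m * (Q div p) ≡ c * p ^ e
  m[Q/p]≡cp^e = *-cancelˡ-≡ (m * (Q div p)) (c * p ^ e) p {{>-nonZero 0<p}} (begin
    p * (m * (Q div p))   ≡⟨ regroup p m (Q div p) ⟩
    m * (Q div p * p)     ≡⟨ cong (m *_) (div*≡ {{>-nonZero 0<p}} p∣Q) ⟩
    m * Q                 ≡⟨ *-comm m Q ⟩
    Q * m                 ≡⟨ Qm≡cp^[1+e] ⟩
    c * (p * p ^ e)       ≡⟨ *-comm c _ ⟩
    p * p ^ e * c         ≡⟨ *-assoc p (p ^ e) c ⟩
    p * (p ^ e * c)       ≡⟨ cong (p *_) (*-comm (p ^ e) c) ⟩
    p * (c * p ^ e)       ∎)
    where
    open ≡-Reasoning
    regroup : ∀ a b c → a * (b * c) ≡ b * (c * a)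
    regroup = solve-∀

noObstruction⇒𝔑 : ∀ {Q m} → WeakPrimaryPseudoperfect Q → 𝔫 Q ∣ m → 0 < m →
                  (∀ {p} → ¬ ObstructingPrime Q m p) → 𝔑 Q m
noObstruction⇒𝔑 {Q} {m} Q-wpp@(0<Q , _) 𝔫∣m 0<m unobstructed =
  0<m , ∣-from-prime-powers 0<k (λ e p-prime p^[1+e]∣k → ≡mod⇒≡[mod] (S[k,k]≡m e p-prime p^[1+e]∣k))
  where
  k = Q * m
  0<k : 0 < k
  0<k = *-mono-< 0<Q 0<m
  instance
    k≢0 : NonZero k
    k≢0 = >-nonZero 0<k
  S[k,k]≡m : ∀ {p} e → Prime p → p ^ suc e ∣ k → + S k k ≡ + m ⟨mod p ^ suc e ⟩
  S[k,k]≡m {p} e p-prime (divides c k≡cp^[1+e]) with p ∣? Q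
  ... | yes p∣Q = ≡mod-trans (S[k,k]≡-c*p^e {c = c} {e = e} p-prime p-1∣k k≡cp^[1+e])
                    (≡mod-sym (WPP⇒m≡-c*p^e {c = c} {e = e} Q-wpp p-prime p∣Q k≡cp^[1+e]))
    where
    p-1∣k : (p ∸ 1) ∣ k
    p-1∣k = ∣-trans (q-1∣Q*𝔫 0<Q (∈primeDivisors⁺ 0<Q p-prime p∣Q)) (*-monoʳ-∣ Q 𝔫∣m)
  ... | no p∤Q = ≡mod-trans (S[k,k]≡0 {c = c} {e = e} p-prime p-1∤k k≡cp^[1+e])
                   (≡mod-sym (∣⇒≡mod0 (p^n∣m*o⇒p^n∣o p-prime p∤Q (suc e) (divides c k≡cp^[1+e]))))
    where
    p∣m : p ∣ m
    p∣m with euclidsLemma Q m p-prime (∣-trans (m∣m*n (p ^ e)) (divides c k≡cp^[1+e]))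
    ... | inj₁ p∣Q = contradiction p∣Q p∤Q
    ... | inj₂ p∣m = p∣m
    p-1∤k : ¬ (p ∸ 1) ∣ k
    p-1∤k p-1∣k = unobstructed (p-prime , p∤Q , p∣m , p-1∣k)

-- The sets W_d(Q)

p*[p-1]/d≡p*[[p-1]/d] : ∀ p {d} → 0 < d → d ∣ p ∸ 1 → (p * (p ∸ 1)) div d ≡ p * ((p ∸ 1) div d)
p*[p-1]/d≡p*[[p-1]/d] p {d@(suc _)} _ d∣p-1 = *-/-assoc p d∣p-1

lcm≡m/gcd*n : ∀ m n → 0 < n → lcm m n ≡ m div gcd m n * n
lcm≡m/gcd*n m n 0<n = *-cancelˡ-≡ (lcm m n) _ (gcd m n) {{>-nonZero 0<g}} (begin
  gcd m n * lcm m n          ≡⟨ gcd*lcm m n ⟩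
  m * n                      ≡⟨ cong (_* n) (div*≡ {{>-nonZero 0<g}} (gcd[m,n]∣m m n)) ⟨
  m div gcd m n * gcd m n * n ≡⟨ regroup (m div gcd m n) (gcd m n) n ⟩
  gcd m n * (m div gcd m n * n) ∎)
  where
  open ≡-Reasoning
  0<g : 0 < gcd m n
  0<g = gcd>0 m 0<n
  regroup : ∀ x g n → x * g * n ≡ g * (x * n)
  regroup = solve-∀

W⇒MultOf𝔫 : ∀ {d Q m} → 0 < d → W d Q m → MultOf𝔫 Q m
W⇒MultOf𝔫 {d} {Q} {m} 0<d (p , K , p-prime , _ , d∣p-1 , 0<K , m≡Kpxa) = K * y , *-mono-< 0<K 0<y , (begin
  m                            ≡⟨ m≡Kpxa ⟩
  K * p * x * a                ≡⟨ regroup K p x a ⟩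
  K * x * (p * a)              ≡⟨ cong (K * x *_) (sym B≡pa) ⟩
  K * x * B                    ≡⟨ cong (K * x *_) (sym (div*≡ {{>-nonZero 0<g}} (gcd[m,n]∣n 𝔫Q B))) ⟩
  K * x * (y * g)              ≡⟨ regroup′ K x y g ⟩
  x * g * (K * y)              ≡⟨ cong (_* (K * y)) (div*≡ {{>-nonZero 0<g}} (gcd[m,n]∣m 𝔫Q B)) ⟩
  𝔫Q * (K * y)                 ∎)
  where
  open ≡-Reasoning
  𝔫Q = 𝔫 Q
  a = (p ∸ 1) div d
  B = (p * (p ∸ 1)) div d
  B≡pa : B ≡ p * a
  B≡pa = p*[p-1]/d≡p*[[p-1]/d] p 0<d d∣p-1
  0<B : 0 < B
  0<B = subst (0 <_) (sym B≡pa) (*-mono-< (prime⇒0<p p-prime)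
          (div>0 {{>-nonZero 0<d}} d∣p-1 (m<n⇒0<n∸m (prime>1 p-prime))))
  g = gcd 𝔫Q B
  0<g : 0 < g
  0<g = gcd>0 𝔫Q 0<B
  x = 𝔫Q div g
  y = B div g
  0<y : 0 < y
  0<y = div>0 {{>-nonZero 0<g}} (gcd[m,n]∣n 𝔫Q B) 0<B
  regroup : ∀ K p x a → K * p * x * a ≡ K * x * (p * a)
  regroup = solve-∀
  regroup′ : ∀ K x y g → K * x * (y * g) ≡ x * g * (K * y)
  regroup′ = solve-∀

W⇒obstruction : ∀ {d Q m} → 0 < d → d ∣ Q → W d Q m → ∃[ p ] ObstructingPrime Q m p
W⇒obstruction {d} {Q} {m} 0<d (divides q Q≡qd) (p , K , p-prime , p∤Q , d∣p-1 , _ , m≡Kpxa) =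
  p , p-prime , p∤Q , divides (K * x * a) (trans m≡Kpxa (regroup K p x a)) , divides (q * K * p * x) (begin
    Q * m                     ≡⟨ cong₂ _*_ Q≡qd m≡Kpxa ⟩
    q * d * (K * p * x * a)   ≡⟨ regroup′ q d K p x a ⟩
    q * K * p * x * (a * d)   ≡⟨ cong (q * K * p * x *_) (div*≡ {{>-nonZero 0<d}} d∣p-1) ⟩
    q * K * p * x * (p ∸ 1)   ∎)
  where
  open ≡-Reasoning
  a = (p ∸ 1) div d
  x = 𝔫 Q div gcd (𝔫 Q) ((p * (p ∸ 1)) div d)
  regroup : ∀ K p x a → K * p * x * a ≡ K * x * a * p
  regroup = solve-∀
  regroup′ : ∀ q d K p x a → q * d * (K * p * x * a) ≡ q * K * p * x * (a * d)
  regroup′ = solve-∀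

obstruction⇒p*[p-1]/d∣m : ∀ {Q m p} → 0 < Q → ObstructingPrime Q m p → p * ((p ∸ 1) div gcd (p ∸ 1) Q) ∣ m
obstruction⇒p*[p-1]/d∣m {Q} {m} {p} 0<Q (p-prime , _ , p∣m , p-1∣Qm) =
  coprime∧∣⇒*∣ (prime⇒coprime p-prime {{>-nonZero 0<a}} a<p) p∣m a∣m
  where
  d = gcd (p ∸ 1) Q
  instance
    d≢0 : NonZero d
    d≢0 = >-nonZero (gcd>0 (p ∸ 1) 0<Q)
  a = (p ∸ 1) div d
  0<p-1 : 0 < p ∸ 1
  0<p-1 = m<n⇒0<n∸m (prime>1 p-prime)
  0<a : 0 < a
  0<a = div>0 (gcd[m,n]∣m (p ∸ 1) Q) 0<p-1
  a<p : a < p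
  a<p = ≤-<-trans (∣⇒≤ {{>-nonZero 0<p-1}} a∣p-1) (∸-monoʳ-< z<s (<⇒≤ (prime>1 p-prime)))
    where
    a∣p-1 : a ∣ p ∸ 1
    a∣p-1 = subst (_∣ p ∸ 1) (sym (div≡/ (p ∸ 1) d)) (m/n∣m (gcd[m,n]∣m (p ∸ 1) Q))
  a∣m : a ∣ m
  a∣m = coprime-divisor (subst₂ Coprime (sym (div≡/ (p ∸ 1) d)) (sym (div≡/ Q d)) (coprime-/gcd (p ∸ 1) Q))
    (*-cancelʳ-∣ d (subst₂ _∣_ (sym (div*≡ (gcd[m,n]∣m (p ∸ 1) Q)))
      (trans (cong (_* m) (sym (div*≡ (gcd[m,n]∣n (p ∸ 1) Q)))) (regroup (Q div d) d m)) p-1∣Qm))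
    where
    regroup : ∀ q d m → q * d * m ≡ q * m * d
    regroup = solve-∀

obstruction⇒W : ∀ {Q m p} → 0 < Q → 0 < m → 𝔫 Q ∣ m → ObstructingPrime Q m p →
                ∃[ d ] (1 ≤ d × d ∣ Q × W d Q m)
obstruction⇒W {Q} {m} {p} 0<Q 0<m 𝔫∣m obstructs@(p-prime , p∤Q , _) =
  d , 0<d , gcd[m,n]∣n (p ∸ 1) Q , p , K , p-prime , p∤Q , gcd[m,n]∣m (p ∸ 1) Q , 0<K , m≡Kpxa
  where
  open ≡-Reasoning
  d = gcd (p ∸ 1) Q
  0<d : 0 < d
  0<d = gcd>0 (p ∸ 1) 0<Q
  a = (p ∸ 1) div d
  B = (p * (p ∸ 1)) div d
  B≡pa : B ≡ p * a
  B≡pa = p*[p-1]/d≡p*[[p-1]/d] p 0<d (gcd[m,n]∣m (p ∸ 1) Q)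
  x = 𝔫 Q div gcd (𝔫 Q) B
  lcm∣m : lcm (𝔫 Q) B ∣ m
  lcm∣m = lcm-least 𝔫∣m (subst (_∣ m) (sym B≡pa) (obstruction⇒p*[p-1]/d∣m 0<Q obstructs))
  K = quotient lcm∣m
  0<K : 0 < K
  0<K = m*n>0⇒m>0 K (subst (0 <_) (m∣n⇒n≡quotient*m lcm∣m) 0<m)
  0<B : 0 < B
  0<B = subst (0 <_) (sym B≡pa) (*-mono-< (prime⇒0<p p-prime)
    (div>0 {{>-nonZero 0<d}} (gcd[m,n]∣m (p ∸ 1) Q) (m<n⇒0<n∸m (prime>1 p-prime))))
  m≡Kpxa : m ≡ K * p * x * a
  m≡Kpxa = begin
    m                         ≡⟨ m∣n⇒n≡quotient*m lcm∣m ⟩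
    K * lcm (𝔫 Q) B           ≡⟨ cong (K *_) (lcm≡m/gcd*n (𝔫 Q) B 0<B) ⟩
    K * (x * B)               ≡⟨ cong (λ y → K * (x * y)) B≡pa ⟩
    K * (x * (p * a))         ≡⟨ regroup K x p a ⟩
    K * p * x * a             ∎
    where
    regroup : ∀ K x p a → K * (x * (p * a)) ≡ K * p * x * a
    regroup = solve-∀

proposition6 : (Q : ℕ) → WeakPrimaryPseudoperfect Q → (∃[ n ] 𝔑 Q n) →
    (m : ℕ) →
      ((MultOf𝔫 Q m × ¬ 𝔑 Q m) → ∃[ d ] (1 ≤ d × d ∣ Q × W d Q m))
    × (∃[ d ] (1 ≤ d × d ∣ Q × W d Q m) → (MultOf𝔫 Q m × ¬ 𝔑 Q m))
proposition6 Q Q-wpp@(0<Q , _) _ m = outside𝔑⇒W , W⇒outside𝔑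
  where
  outside𝔑⇒W : MultOf𝔫 Q m × ¬ 𝔑 Q m → ∃[ d ] (1 ≤ d × d ∣ Q × W d Q m)
  outside𝔑⇒W ((k , 0<k , m≡𝔫k) , m∉𝔑) = case obstruction? Q 0<m of λ where
      (yes (p , obstructs)) → obstruction⇒W 0<Q 0<m 𝔫∣m obstructs
      (no unobstructed) → contradiction (noObstruction⇒𝔑 Q-wpp 𝔫∣m 0<m (λ obstructs → unobstructed (_ , obstructs))) m∉𝔑
    where
    0<m : 0 < m
    0<m = subst (0 <_) (sym m≡𝔫k) (*-mono-< (𝔫>0 0<Q) 0<k)
    𝔫∣m : 𝔫 Q ∣ m
    𝔫∣m = divides k (trans m≡𝔫k (*-comm (𝔫 Q) k))
  W⇒outside𝔑 : ∃[ d ] (1 ≤ d × d ∣ Q × W d Q m) → MultOf𝔫 Q m × ¬ 𝔑 Q m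
  W⇒outside𝔑 (d , 0<d , d∣Q , m∈W) =
    W⇒MultOf𝔫 0<d m∈W , obstruction⇒¬𝔑 0<Q (proj₂ (W⇒obstruction 0<d d∣Q m∈W))
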